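{- Let $\lambda=(\lambda_1,\dots,\lambda_l)$ and $\mu$ be partitions fitting in the $k\times(n-k)$ box, and let $R=(\lambda,\mu,k\times(n-k))$. If $\lambda_1=n-k$, then $\mathrm{poset}(R)$ is isomorphic to $\mathrm{poset}(\widetilde R)$, where $\widetilde R=((\lambda_2,\dots,\lambda_l),\mu,(k-1)\times(n-k))$.
   Context: For finite nonempty $a,b\subset\mathbb{Z}_{>0}$, $a\le b$ means $\max a\le\min b$, $a<b$ means $\max a<\min b$. A set-valued tableau fills a (skew) diagram with finite nonempty subsets of $\mathbb{Z}_{>0}$; semistandard means weakly increasing ($\le$) along rows and strictly increasing ($<$) down columns. The skew shape $\lambda\times\mu$ places the diagram of $\mu$ directly southwest of that of $\lambda$. The word of a tableau reads rows top to bottom, each right to left, elements of a box in decreasing order; it is a reverse lattice word if every initial segment has, for each $i\ge1$, at least as many $i$'s as $(i+1)$'s. The content of a tableau is $(c_1,c_2,\dots)$ with $c_i$ the number of occurrences of $i$. For a triple $R=(\lambda,\mu,a\times b)$, a Buch tableau is a semistandard set-valued tableau of shape $\lambda\times\mu$ with reverse lattice word whose content fits in the $a\times b$ box (at most $a$ parts, each at most $b$); $\mathrm{poset}(R)$ is the set of contents of Buch tableaux for $R$, ordered by $\nu\le\nu'$ iff $\nu\supseteq\nu'$ (each element labeled by the Buch tableaux of that content). -}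

module Defs where

open import Data.Nat using (ℕ; zero; suc; _+_; _∸_; _≤_; _<_; _⊔_; _≟_)
open import Data.List using (List; []; _∷_; _++_; map; reverse; concatMap; length; filter; take; foldr)
open import Data.List.Relation.Unary.All using (All)
open import Data.List.Relation.Unary.Linked using (Linked)
open import Data.Vec using (Vec; tabulate; lookup)
open import Data.Fin using (Fin; toℕ)
open import Data.Empty using (⊥)
open import Data.Maybe using (Maybe; just; nothing)
open import Data.Product using (Σ; ∃; _×_; _,_)
open import Relation.Binary.PropositionalEquality using (_≡_)
open import Function.Bundles using (_⇔_)

IsPartition : List ℕ → Set
IsPartition p = Linked (λ x y → y ≤ x) p × All (λ x → 0 < x) p

FitsIn : ℕ → ℕ → List ℕ → Set
FitsIn a b p = length p ≤ a × All (λ x → x ≤ b) p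

-- Finite nonempty subsets of ℤ_{>0}, represented canonically as
-- nonempty strictly increasing lists of positive integers.

Cell : Set
Cell = List ℕ

IsCell : Cell → Set
IsCell [] = ⊥
IsCell (x ∷ xs) = Linked _<_ (x ∷ xs) × All (λ y → 0 < y) (x ∷ xs)

minC : Cell → ℕ
minC []      = 0
minC (x ∷ _) = x

maxC : Cell → ℕ
maxC = foldr _⊔_ 0

_≤C_ : Cell → Cell → Set
a ≤C b = maxC a ≤ minC b

_<C_ : Cell → Cell → Set
a <C b = maxC a < minC b

-- Skew shape λ × μ: the diagram of μ placed directly southwest of λ.
-- Row r is given as (starting column, length).

head0 : List ℕ → ℕ
head0 []      = 0
head0 (x ∷ _) = x

skewRows : List ℕ → List ℕ → List (ℕ × ℕ)
skewRows lam mu = map (λ x → head0 mu , x) lam ++ map (λ m → 0 , m) mu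

lookupM : {A : Set} → List A → ℕ → Maybe A
lookupM []       _       = nothing
lookupM (x ∷ xs) zero    = just x
lookupM (x ∷ xs) (suc i) = lookupM xs i

-- A filling: list of rows, each a list of cells (left to right).
Tableau : Set
Tableau = List (List Cell)

HasShape : List (ℕ × ℕ) → Tableau → Set
HasShape rows T = map (λ { (s , l) → l }) rows ≡ map length T

record SemistandardSV (rows : List (ℕ × ℕ)) (T : Tableau) : Set where
  field
    shape  : HasShape rows T
    cells  : All (All IsCell) T
    rowWeak : All (Linked _≤C_) T
    colStrict : ∀ r s s' l l' row row' i i' a b →
      lookupM rows r ≡ just (s , l) → lookupM rows (suc r) ≡ just (s' , l') →
      lookupM T r ≡ just row → lookupM T (suc r) ≡ just row' →
      lookupM row i ≡ just a → lookupM row' i' ≡ just b →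
      s + i ≡ s' + i' → a <C b

-- Rows top to bottom, each right to left, elements of a box decreasing.
word : Tableau → List ℕ
word T = concatMap (λ row → concatMap reverse (reverse row)) T

count : ℕ → List ℕ → ℕ
count i w = length (filter (λ x → x ≟ i) w)

IsReverseLattice : List ℕ → Set
IsReverseLattice w = ∀ m i → 1 ≤ i → count (suc i) (take m w) ≤ count i (take m w)

record Triple : Set where
  constructor triple
  field
    lam : List ℕ
    mu  : List ℕ
    a   : ℕ
    b   : ℕ
open Triple public

ContentFits : ℕ → ℕ → List ℕ → Set
ContentFits a b w = (∀ i → count i w ≤ b) × (∀ i → a < i → count i w ≡ 0)

record Buch (R : Triple) (T : Tableau) : Set where
  field
    ssyt    : SemistandardSV (skewRows (lam R) (mu R)) T
    lattice : IsReverseLattice (word T)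
    fits    : ContentFits (a R) (b R) (word T)

-- The content (c₁, …, c_a) of a tableau, recorded as a vector of length a
-- (for a Buch tableau all c_i with i > a vanish).
content : (R : Triple) → Tableau → Vec ℕ (a R)
content R T = tabulate (λ i → count (suc (toℕ i)) (word T))

-- Buch tableaux of R with content ν (the label of ν in poset(R)).
BuchWithContent : (R : Triple) → Vec ℕ (a R) → Tableau → Set
BuchWithContent R ν T = Buch R T × content R T ≡ ν

InPoset : (R : Triple) → Vec ℕ (a R) → Set
InPoset R ν = ∃ λ T → BuchWithContent R ν T

-- ν ≤ ν'  iff  ν ⊇ ν'
_≤P_ : {m : ℕ} → Vec ℕ m → Vec ℕ m → Set
ν ≤P ν' = ∀ i → lookup ν' i ≤ lookup ν i

record LabeledPosetIso (R R' : Triple) : Set where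
  field
    f : Vec ℕ (a R) → Vec ℕ (a R')
    g : Vec ℕ (a R') → Vec ℕ (a R)
    f-in : ∀ ν → InPoset R ν → InPoset R' (f ν)
    g-in : ∀ ν' → InPoset R' ν' → InPoset R (g ν')
    gf : ∀ ν → InPoset R ν → g (f ν) ≡ ν
    fg : ∀ ν' → InPoset R' ν' → f (g ν') ≡ ν'
    order : ∀ ν₁ ν₂ → InPoset R ν₁ → InPoset R ν₂ → (ν₁ ≤P ν₂ ⇔ f ν₁ ≤P f ν₂)
    h  : Vec ℕ (a R) → Tableau → Tableau
    h' : Vec ℕ (a R) → Tableau → Tableau
    h-in  : ∀ ν T → InPoset R ν → BuchWithContent R ν T → BuchWithContent R' (f ν) (h ν T)
    h'-in : ∀ ν T' → InPoset R ν → BuchWithContent R' (f ν) T' → BuchWithContent R ν (h' ν T')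
    h'h : ∀ ν T → InPoset R ν → BuchWithContent R ν T → h' ν (h ν T) ≡ T
    hh' : ∀ ν T' → InPoset R ν → BuchWithContent R' (f ν) T' → h ν (h' ν T') ≡ T'

-- Write B = n − k.  The first row of a Buch tableau T for R = (B ∷ λ', μ, k × B)
-- is read first and its reading word is weakly decreasing, so the reverse lattice
-- condition makes every box of it {1}; as c₁ ≤ B, no other box contains 1.  Hence
-- T = attach D, a row of B boxes {1} on top of D with all entries raised by one,
-- for a Buch tableau D of R' = (λ', μ, (k−1) × B), and conversely.  On reading
-- words attach turns w into lift B w = 1ᴮ(w + 1), so content(attach D) = B ∷ content D.
module Submission where

open import Defs
open import Data.Nat using (ℕ; zero; suc; pred; _+_; _∸_; _≤_; _<_; _≥_; _⊔_; _≟_; z≤n; s≤s)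
open import Data.Nat.Properties
  using (≤-refl; ≤-trans; ≤-antisym; ≤-reflexive; ≤-total; <⇒≤; <⇒≤pred; <-trans; <-irrefl; n≮0;
         m≤m+n; m≤m⊔n; m≤n⊔m; ⊔-identityʳ; +-identityʳ; +-cancelˡ-≤; m+[n∸m]≡n; n≤0⇒n≡0;
         pred-mono-≤; n≢0⇒n>0; suc-injective)
open import Data.List using (List; []; _∷_; [_]; _++_; map; reverse; concat; concatMap; length; filter; take; drop; replicate)
open import Data.List.Properties
  using (filter-accept; filter-reject; filter-++; filter-none; filter-all; filter-some; length-++; length-map;
         length-replicate; take-map; take++drop≡id; map-∘; map-cong; map-id; map-id-local; map-++; concat-++;
         ++-identityʳ; unfold-reverse; reverse-map; concatMap-map; concatMap-cong; map-concatMap;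
         ∷-injectiveˡ; ∷-injectiveʳ)
open import Data.List.Relation.Unary.All as All using (All; []; _∷_)
import Data.List.Relation.Unary.All.Properties as Allₚ
import Data.List.Relation.Unary.Any.Properties as Anyₚ
open import Data.List.Relation.Unary.AllPairs as AllPairs using (AllPairs; []; _∷_)
import Data.List.Relation.Unary.AllPairs.Properties as AllPairsₚ
open import Data.List.Relation.Unary.Linked as Linked using (Linked; []; [-]; _∷_)
import Data.List.Relation.Unary.Linked.Properties as Linkedₚ
open import Data.Vec as Vec using (_∷_; tabulate)
open import Data.Vec.Properties using (tabulate-cong)
open import Data.Fin using (toℕ; zero; suc)
open import Data.Empty using (⊥-elim)
open import Data.Maybe using (just)
open import Data.Product using (Σ; _×_; _,_; proj₁; proj₂)
open import Data.Sum using (inj₁; inj₂)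
open import Function using (_∘_; flip)
open import Function.Bundles using (_⇔_; mk⇔; Equivalence)
open import Relation.Nullary using (yes; no)
open import Relation.Binary.PropositionalEquality
  using (_≡_; _≢_; refl; sym; trans; cong; cong₂; subst; subst₂; module ≡-Reasoning)

open Equivalence using (to; from)

count-accept : ∀ {i x} w → x ≡ i → count i (x ∷ w) ≡ suc (count i w)
count-accept {i} w x≡i = cong length (filter-accept (_≟ i) x≡i)

count-reject : ∀ {i x} w → x ≢ i → count i (x ∷ w) ≡ count i w
count-reject {i} w x≢i = cong length (filter-reject (_≟ i) x≢i)

count-++ : ∀ i xs ys → count i (xs ++ ys) ≡ count i xs + count i ys
count-++ i xs ys = trans (cong length (filter-++ (_≟ i) xs ys)) (length-++ (filter (_≟ i) xs))

count-none : ∀ {i w} → All (_≢ i) w → count i w ≡ 0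
count-none {i} absent = cong length (filter-none (_≟ i) absent)

count-zero : ∀ {i} w → count i w ≡ 0 → All (_≢ i) w
count-zero {i} w c = Allₚ.¬Any⇒All¬ w (λ hit → n≮0 (subst (0 <_) c (filter-some (_≟ i) hit)))

count-positive : ∀ {w} → All (0 <_) w → count 0 w ≡ 0
count-positive pos = count-none (All.map (λ { (s≤s _) () }) pos)

count-take : ∀ i m w → count i (take m w) ≤ count i w
count-take i m w =
  subst (count i (take m w) ≤_)
        (trans (sym (count-++ i (take m w) (drop m w))) (cong (count i) (take++drop≡id m w)))
        (m≤m+n _ _)

count-suc : ∀ j w → count (suc j) (map suc w) ≡ count j w
count-suc j [] = refl
count-suc j (x ∷ w) with x ≟ j
... | yes x≡j = trans (count-accept (map suc w) (cong suc x≡j))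
                      (trans (cong suc (count-suc j w)) (sym (count-accept w x≡j)))
... | no x≢j  = trans (count-reject (map suc w) (x≢j ∘ suc-injective))
                      (trans (count-suc j w) (sym (count-reject w x≢j)))

count-ones : ∀ n → count 1 (replicate n 1) ≡ n
count-ones n = trans (cong length (filter-all (_≟ 1) (Allₚ.replicate⁺ n refl))) (length-replicate n)

count-ones-other : ∀ {i} n → 1 ≢ i → count i (replicate n 1) ≡ 0
count-ones-other n 1≢i = count-none (Allₚ.replicate⁺ n 1≢i)

-- The lifted word: prefix B ones and raise every letter of w by one.  It is the
-- reading word of w's tableau with a full row of {1}'s put on top.

lift : ℕ → List ℕ → List ℕ
lift B w = replicate B 1 ++ map suc w

count-lift-zero : ∀ B w → count 0 (lift B w) ≡ 0
count-lift-zero B w =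
  trans (count-++ 0 (replicate B 1) (map suc w))
        (cong₂ _+_ (count-ones-other B (λ ())) (count-none (Allₚ.map⁺ (All.universal (λ _ ()) w))))

count-lift-one : ∀ B w → count 1 (lift B w) ≡ B + count 0 w
count-lift-one B w =
  trans (count-++ 1 (replicate B 1) (map suc w)) (cong₂ _+_ (count-ones B) (count-suc 0 w))

count-lift-high : ∀ B j w → count (suc (suc j)) (lift B w) ≡ count (suc j) w
count-lift-high B j w =
  trans (count-++ _ (replicate B 1) (map suc w))
        (cong₂ _+_ (count-ones-other B (λ ())) (count-suc (suc j) w))

take-lift-short : ∀ B m w → m ≤ B → take m (lift B w) ≡ replicate m 1
take-lift-short B       zero    w _         = refl
take-lift-short (suc B) (suc m) w (s≤s m≤B) = cong (1 ∷_) (take-lift-short B m w m≤B)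

take-lift : ∀ B m w → take (B + m) (lift B w) ≡ lift B (take m w)
take-lift zero    m w = take-map m w
take-lift (suc B) m w = cong (1 ∷_) (take-lift B m w)

count-take-lift : ∀ B m w i → count (suc (suc i)) (take (B + m) (lift B w)) ≡ count (suc i) (take m w)
count-take-lift B m w i = trans (cong (count (suc (suc i))) (take-lift B m w)) (count-lift-high B i (take m w))

count-short-prefix : ∀ B m w j → m ≤ B → count (suc (suc j)) (take m (lift B w)) ≡ 0
count-short-prefix B m w j m≤B =
  trans (cong (count (suc (suc j))) (take-lift-short B m w m≤B)) (count-ones-other m (λ ()))

lattice-unlift : ∀ B w → IsReverseLattice (lift B w) → IsReverseLattice w
lattice-unlift B w lattice m (suc j) _ =
  subst₂ _≤_ (count-take-lift B m w (suc j)) (count-take-lift B m w j) (lattice (B + m) (suc (suc j)) (s≤s z≤n))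

-- Conversely, the extra condition for the letter pair (1, 2) holds as soon as c₁(w) ≤ B.
lattice-lift : ∀ B w → IsReverseLattice w → count 1 w ≤ B → IsReverseLattice (lift B w)
lattice-lift B w lattice c₁≤B m (suc j) _ with ≤-total m B
... | inj₁ m≤B = subst (_≤ count (suc j) (take m (lift B w))) (sym (count-short-prefix B m w j m≤B)) z≤n
... | inj₂ B≤m = subst (λ m → count (suc (suc j)) (take m (lift B w)) ≤ count (suc j) (take m (lift B w)))
                       (m+[n∸m]≡n B≤m) (long (m ∸ B) j)
  where
  long : ∀ q j → count (suc (suc j)) (take (B + q) (lift B w)) ≤ count (suc j) (take (B + q) (lift B w))
  long q zero =
    subst₂ _≤_ (sym (count-take-lift B q w 0))
               (sym (trans (cong (count 1) (take-lift B q w)) (count-lift-one B (take q w))))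
               (≤-trans (≤-trans (count-take 1 q w) c₁≤B) (m≤m+n B _))
  long q (suc j) =
    subst₂ _≤_ (sym (count-take-lift B q w (suc j))) (sym (count-take-lift B q w j))
               (lattice q (suc j) (s≤s z≤n))

fits-unlift : ∀ {k B} w → ContentFits (suc k) B (lift B w) → count 0 w ≡ 0 × ContentFits k B w
fits-unlift {k} {B} w (bounded , vanish) = no-zero , bounded′ , vanish′
  where
  no-zero : count 0 w ≡ 0
  no-zero = n≤0⇒n≡0 (+-cancelˡ-≤ B (count 0 w) 0
                       (subst₂ _≤_ (count-lift-one B w) (sym (+-identityʳ B)) (bounded 1)))
  bounded′ : ∀ i → count i w ≤ B
  bounded′ zero    = subst (_≤ B) (sym no-zero) z≤n
  bounded′ (suc j) = subst (_≤ B) (count-lift-high B j w) (bounded (suc (suc j)))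
  vanish′ : ∀ i → k < i → count i w ≡ 0
  vanish′ (suc j) k<i = trans (sym (count-lift-high B j w)) (vanish (suc (suc j)) (s≤s k<i))

fits-lift : ∀ {k B} w → count 0 w ≡ 0 → ContentFits k B w → ContentFits (suc k) B (lift B w)
fits-lift {k} {B} w no-zero (bounded , vanish) = bounded′ , vanish′
  where
  bounded′ : ∀ i → count i (lift B w) ≤ B
  bounded′ zero          = subst (_≤ B) (sym (count-lift-zero B w)) z≤n
  bounded′ (suc zero)    = subst (_≤ B) (sym (trans (count-lift-one B w)
                                                    (trans (cong (B +_) no-zero) (+-identityʳ B)))) ≤-refl
  bounded′ (suc (suc j)) = subst (_≤ B) (sym (count-lift-high B j w)) (bounded (suc j))
  vanish′ : ∀ i → suc k < i → count i (lift B w) ≡ 0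
  vanish′ (suc zero)    (s≤s ())
  vanish′ (suc (suc j)) (s≤s k<j+1) = trans (count-lift-high B j w) (vanish (suc j) k<j+1)

counts-lift : ∀ {k} B w → count 0 w ≡ 0 →
  tabulate {n = suc k} (λ i → count (suc (toℕ i)) (lift B w)) ≡ B ∷ tabulate (λ i → count (suc (toℕ i)) w)
counts-lift B w no-zero =
  cong₂ _∷_ (trans (count-lift-one B w) (trans (cong (B +_) no-zero) (+-identityʳ B)))
            (tabulate-cong (λ i → count-lift-high B (toℕ i) w))

lattice-head : ∀ M w → IsReverseLattice (M ∷ w) → M ≤ 1
lattice-head zero          w lattice = z≤n
lattice-head (suc zero)    w lattice = ≤-refl
lattice-head (suc (suc j)) w lattice
  with subst₂ _≤_ (count-accept {suc (suc j)} [] refl) (count-reject {suc j} {suc (suc j)} [] (λ ()))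
                  (lattice 1 (suc j) (s≤s z≤n))
... | ()

decreasing-lattice-ones : ∀ u v → AllPairs _≥_ u → All (0 <_) u → IsReverseLattice (u ++ v) → All (_≡ 1) u
decreasing-lattice-ones []      v _             _            _       = []
decreasing-lattice-ones (M ∷ u) v (M≥u ∷ _) (0<M ∷ pos) lattice =
  ≤-antisym M≤1 0<M ∷ All.zipWith (λ { (x≤M , 0<x) → ≤-antisym (≤-trans x≤M M≤1) 0<x }) (M≥u , pos)
  where
  M≤1 : M ≤ 1
  M≤1 = lattice-head M (u ++ v) lattice

rowWord : List Cell → List ℕ
rowWord row = concatMap reverse (reverse row)

rowWord-∷ : ∀ d cs → rowWord (d ∷ cs) ≡ rowWord cs ++ reverse d
rowWord-∷ d cs = begin
  concat (map reverse (reverse (d ∷ cs)))            ≡⟨ cong (concatMap reverse) (unfold-reverse d cs) ⟩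
  concat (map reverse (reverse cs ++ [ d ]))         ≡⟨ cong concat (map-++ reverse (reverse cs) [ d ]) ⟩
  concat (map reverse (reverse cs) ++ [ reverse d ]) ≡⟨ sym (concat-++ (map reverse (reverse cs)) [ reverse d ]) ⟩
  rowWord cs ++ reverse d ++ []                      ≡⟨ cong (rowWord cs ++_) (++-identityʳ (reverse d)) ⟩
  rowWord cs ++ reverse d                            ∎
  where open ≡-Reasoning

all-reverse : ∀ {A : Set} {P : A → Set} {xs} → All P xs → All P (reverse xs)
all-reverse p = All.tabulate (λ x∈ → All.lookup p (Anyₚ.reverse⁻ x∈))

all-reverse⁻ : ∀ {A : Set} {P : A → Set} {xs} → All P (reverse xs) → All P xs
all-reverse⁻ p = All.tabulate (λ x∈ → All.lookup p (Anyₚ.reverse⁺ x∈))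

allPairs-reverse : ∀ {A : Set} {R : A → A → Set} {xs} → AllPairs R xs → AllPairs (flip R) (reverse xs)
allPairs-reverse []                         = []
allPairs-reverse {R = R} {x ∷ xs} (Rx ∷ Rxs) =
  subst (AllPairs (flip R)) (sym (unfold-reverse x xs))
        (AllPairsₚ.++⁺ (allPairs-reverse Rxs) ([] ∷ []) (All.map (_∷ []) (all-reverse Rx)))

row-letters : ∀ {P : ℕ → Set} row → All P (rowWord row) ⇔ All (All P) row
row-letters row =
  mk⇔ (λ p → All.map all-reverse⁻ (all-reverse⁻ (Allₚ.map⁻ (Allₚ.concat⁻ p))))
      (λ p → Allₚ.concat⁺ (Allₚ.map⁺ (all-reverse (All.map all-reverse p))))

word-letters : ∀ {P : ℕ → Set} T → All P (word T) ⇔ All (All (All P)) T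
word-letters T =
  mk⇔ (λ p → All.map (λ {row} → to (row-letters row)) (Allₚ.map⁻ (Allₚ.concat⁻ p)))
      (λ p → Allₚ.concat⁺ (Allₚ.map⁺ (All.map (λ {row} → from (row-letters row)) p)))

rowWord-map : ∀ (g : ℕ → ℕ) row → rowWord (map (map g) row) ≡ map g (rowWord row)
rowWord-map g row = begin
  concatMap reverse (reverse (map (map g) row))  ≡⟨ cong (concatMap reverse) (sym (reverse-map (map g) row)) ⟩
  concatMap reverse (map (map g) (reverse row))  ≡⟨ concatMap-map reverse (map g) (reverse row) ⟩
  concatMap (reverse ∘ map g) (reverse row)      ≡⟨ concatMap-cong (λ c → sym (reverse-map g c)) (reverse row) ⟩
  concatMap (map g ∘ reverse) (reverse row)      ≡⟨ sym (map-concatMap g reverse (reverse row)) ⟩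
  map g (rowWord row)                            ∎
  where open ≡-Reasoning

word-map : ∀ (g : ℕ → ℕ) T → word (map (map (map g)) T) ≡ map g (word T)
word-map g T = begin
  concatMap rowWord (map (map (map g)) T) ≡⟨ concatMap-map rowWord (map (map g)) T ⟩
  concatMap (rowWord ∘ map (map g)) T     ≡⟨ concatMap-cong (rowWord-map g) T ⟩
  concatMap (map g ∘ rowWord) T           ≡⟨ sym (map-concatMap g rowWord T) ⟩
  map g (word T)                          ∎
  where open ≡-Reasoning

replicate-∷ʳ : ∀ {A : Set} n (x : A) → replicate n x ++ [ x ] ≡ x ∷ replicate n x
replicate-∷ʳ zero    x = refl
replicate-∷ʳ (suc n) x = cong (x ∷_) (replicate-∷ʳ n x)

rowWord-ones : ∀ n → rowWord (replicate n [ 1 ]) ≡ replicate n 1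
rowWord-ones zero    = refl
rowWord-ones (suc n) =
  trans (rowWord-∷ [ 1 ] (replicate n [ 1 ])) (trans (cong (_++ [ 1 ]) (rowWord-ones n)) (replicate-∷ʳ n 1))

cell-positive : ∀ {c} → IsCell c → All (0 <_) c
cell-positive {_ ∷ _} (_ , pos) = pos

cell-max : ∀ c → All (_≤ maxC c) c
cell-max []      = []
cell-max (x ∷ c) = m≤m⊔n x (maxC c) ∷ All.map (λ y≤ → ≤-trans y≤ (m≤n⊔m x (maxC c))) (cell-max c)

cell-min : ∀ {c} → IsCell c → All (minC c ≤_) c
cell-min {x ∷ xs} (increasing , _) =
  ≤-refl ∷ All.map <⇒≤ (AllPairs.head (Linkedₚ.Linked⇒AllPairs <-trans increasing))

min≤max : ∀ {c} → IsCell c → minC c ≤ maxC c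
min≤max {x ∷ xs} _ = All.head (cell-max (x ∷ xs))

maxC-positive : ∀ {c} → IsCell c → 0 < maxC c
maxC-positive {_ ∷ _} cell = ≤-trans (All.head (cell-positive cell)) (min≤max cell)

cell-reverse-decreasing : ∀ {c} → IsCell c → AllPairs _≥_ (reverse c)
cell-reverse-decreasing {_ ∷ _} (increasing , _) =
  allPairs-reverse (AllPairs.map <⇒≤ (Linkedₚ.Linked⇒AllPairs <-trans increasing))

cell-ones : ∀ {c} → IsCell c → All (_≡ 1) c → c ≡ [ 1 ]
cell-ones {_ ∷ []}    _                (refl ∷ [])         = refl
cell-ones {_ ∷ _ ∷ _} (1<1 ∷ _ , _) (refl ∷ refl ∷ _) = ⊥-elim (<-irrefl refl 1<1)

-- The reading word of a semistandard row d ∷ cs is weakly decreasing; all its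
-- letters are at least min d (the invariant that makes the induction go through).
row-word-decreasing : ∀ {d cs} → All IsCell (d ∷ cs) → Linked _≤C_ (d ∷ cs) →
  AllPairs _≥_ (rowWord (d ∷ cs)) × All (minC d ≤_) (rowWord (d ∷ cs))
row-word-decreasing {d} {cs} (cell-d ∷ cells) linked =
  subst (λ u → AllPairs _≥_ u × All (minC d ≤_) u) (sym (rowWord-∷ d cs)) (extend cs cells linked)
  where
  extend : ∀ cs → All IsCell cs → Linked _≤C_ (d ∷ cs) →
    AllPairs _≥_ (rowWord cs ++ reverse d) × All (minC d ≤_) (rowWord cs ++ reverse d)
  extend []        []    _               = cell-reverse-decreasing cell-d , all-reverse (cell-min cell-d)
  extend (d′ ∷ cs′) cells′ (d≤d′ ∷ linked′) with row-word-decreasing cells′ linked′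
  ... | decreasing , above-d′ =
    AllPairsₚ.++⁺ decreasing (cell-reverse-decreasing cell-d)
      (All.map (λ d′≤x → all-reverse (All.map (λ y≤ → ≤-trans y≤ (≤-trans d≤d′ d′≤x)) (cell-max d))) above-d′) ,
    Allₚ.++⁺ (All.map (≤-trans (≤-trans (min≤max cell-d) d≤d′)) above-d′) (all-reverse (cell-min cell-d))

row-decreasing : ∀ {row} → All IsCell row → Linked _≤C_ row → AllPairs _≥_ (rowWord row)
row-decreasing {[]}    _     _      = []
row-decreasing {_ ∷ _} cells linked = proj₁ (row-word-decreasing cells linked)

all-replicate : ∀ {A : Set} {x : A} {xs} → All (_≡ x) xs → xs ≡ replicate (length xs) x
all-replicate []           = refl
all-replicate (refl ∷ eqs) = cong (_ ∷_) (all-replicate eqs)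

up : Cell → Cell
up = map suc

down : Cell → Cell
down = map pred

-- Cells whose entries are all at least 2: exactly those that can be lowered.
Big : Cell → Set
Big c = IsCell c × All (1 <_) c

maxC-up : ∀ x xs → maxC (up (x ∷ xs)) ≡ suc (maxC (x ∷ xs))
maxC-up x []       = cong suc (sym (⊔-identityʳ x))
maxC-up x (y ∷ ys) = cong (suc x ⊔_) (maxC-up y ys)

pred-⊔ : ∀ m n → pred (m ⊔ n) ≡ pred m ⊔ pred n
pred-⊔ zero    n       = refl
pred-⊔ (suc m) zero    = sym (⊔-identityʳ m)
pred-⊔ (suc m) (suc n) = refl

maxC-down : ∀ c → maxC (down c) ≡ pred (maxC c)
maxC-down []      = refl
maxC-down (x ∷ c) = trans (cong (pred x ⊔_) (maxC-down c)) (sym (pred-⊔ x (maxC c)))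

minC-down : ∀ c → minC (down c) ≡ pred (minC c)
minC-down []      = refl
minC-down (_ ∷ _) = refl

pred-<-pred : ∀ {m n} → 0 < m → m < n → pred m < pred n
pred-<-pred {suc _} {suc _} _ (s≤s m<n) = m<n

linked-map : ∀ {A : Set} {P : A → Set} {R S : A → A → Set} {f : A → A} →
  (∀ {x y} → P x → P y → R x y → S (f x) (f y)) → ∀ {xs} → All P xs → Linked R xs → Linked S (map f xs)
linked-map g []             []         = []
linked-map g (px ∷ [])      [-]        = [-]
linked-map g (px ∷ py ∷ ps) (r ∷ rs) = g px py r ∷ linked-map g (py ∷ ps) rs

up-IsCell : ∀ {c} → IsCell c → IsCell (up c)
up-IsCell {_ ∷ _} (increasing , pos) =
  Linkedₚ.map⁺ (Linked.map s≤s increasing) , Allₚ.map⁺ (All.map (λ _ → s≤s z≤n) pos)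

up-≤C : ∀ {a b} → IsCell a → IsCell b → a ≤C b → up a ≤C up b
up-≤C {x ∷ xs} {_ ∷ _} _ _ a≤b = subst (_≤ _) (sym (maxC-up x xs)) (s≤s a≤b)

up-<C : ∀ {a b} → IsCell a → IsCell b → a <C b → up a <C up b
up-<C {x ∷ xs} {_ ∷ _} _ _ a<b = subst (λ m → suc m ≤ _) (sym (maxC-up x xs)) (s≤s a<b)

down-IsCell : ∀ {c} → Big c → IsCell (down c)
down-IsCell {_ ∷ _} ((increasing , _) , big) =
  linked-map (λ 1<x _ x<y → pred-<-pred (<⇒≤ 1<x) x<y) big increasing , Allₚ.map⁺ (All.map <⇒≤pred big)

down-≤C : ∀ {a b} → Big a → Big b → a ≤C b → down a ≤C down b
down-≤C {a} {b} _ _ a≤b = subst₂ _≤_ (sym (maxC-down a)) (sym (minC-down b)) (pred-mono-≤ a≤b)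

down-<C : ∀ {a b} → Big a → Big b → a <C b → down a <C down b
down-<C {a} {b} (cell-a , _) _ a<b =
  subst₂ (λ m n → suc m ≤ n) (sym (maxC-down a)) (sym (minC-down b)) (pred-<-pred (maxC-positive cell-a) a<b)

shiftUp : Tableau → Tableau
shiftUp = map (map up)

shiftDown : Tableau → Tableau
shiftDown = map (map down)

map-retract : ∀ {A B : Set} {f : A → B} {g : B → A} → (∀ x → g (f x) ≡ x) → ∀ xs → map g (map f xs) ≡ xs
map-retract gf xs = trans (sym (map-∘ xs)) (trans (map-cong gf xs) (map-id xs))

map-retract-on : ∀ {A B : Set} {f : A → B} {g : B → A} {xs} → All (λ x → g (f x) ≡ x) xs → map g (map f xs) ≡ xs
map-retract-on {xs = xs} gf = trans (sym (map-∘ xs)) (map-id-local gf)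

shiftDown-shiftUp : ∀ D → shiftDown (shiftUp D) ≡ D
shiftDown-shiftUp = map-retract (map-retract (map-retract (λ _ → refl)))

shiftUp-shiftDown : ∀ {T} → All (All IsCell) T → shiftUp (shiftDown T) ≡ T
shiftUp-shiftDown cells =
  map-retract-on (All.map (λ row → map-retract-on (All.map (λ cell → up-down (cell-positive cell)) row)) cells)
  where
  up-down : ∀ {c} → All (0 <_) c → up (down c) ≡ c
  up-down pos = map-retract-on (All.map (λ { (s≤s _) → refl }) pos)

lookupM-map⁻ : ∀ {A B : Set} {f : A → B} xs i {y} → lookupM (map f xs) i ≡ just y →
  Σ A λ x → lookupM xs i ≡ just x × y ≡ f x
lookupM-map⁻ (x ∷ xs) zero    refl = x , refl , refl
lookupM-map⁻ (x ∷ xs) (suc i) e    = lookupM-map⁻ xs i e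

lookupM-All : ∀ {A : Set} {P : A → Set} {xs i x} → All P xs → lookupM xs i ≡ just x → P x
lookupM-All {i = zero}  (px ∷ _)  refl = px
lookupM-All {i = suc i} (_ ∷ pxs) e    = lookupM-All pxs e

map-shape : ∀ (φ : Cell → Cell) T → map length (map (map φ) T) ≡ map length T
map-shape φ T = trans (sym (map-∘ T)) (map-cong (length-map φ) T)

ssyt-map : ∀ {rows T} (φ : Cell → Cell) (P : Cell → Set) →
  (∀ {c} → P c → IsCell (φ c)) →
  (∀ {a b} → P a → P b → a ≤C b → φ a ≤C φ b) →
  (∀ {a b} → P a → P b → a <C b → φ a <C φ b) →
  All (All P) T → SemistandardSV rows T → SemistandardSV rows (map (map φ) T)
ssyt-map {rows} {T} φ P φ-cell φ-≤ φ-< good ssyt = record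
  { shape     = trans shape (sym (map-shape φ T))
  ; cells     = Allₚ.map⁺ (All.map (λ row → Allₚ.map⁺ (All.map φ-cell row)) good)
  ; rowWeak   = Allₚ.map⁺ (All.zipWith (λ { (linked , row) → linked-map φ-≤ row linked }) (rowWeak , good))
  ; colStrict = column }
  where
  open SemistandardSV ssyt
  column : ∀ r s s' l l' row row' i i' a b →
    lookupM rows r ≡ just (s , l) → lookupM rows (suc r) ≡ just (s' , l') →
    lookupM (map (map φ) T) r ≡ just row → lookupM (map (map φ) T) (suc r) ≡ just row' →
    lookupM row i ≡ just a → lookupM row' i' ≡ just b → s + i ≡ s' + i' → a <C b
  column r s s' l l' row row' i i' a b e₁ e₂ e₃ e₄ e₅ e₆ e₇
    with lookupM-map⁻ T r e₃ | lookupM-map⁻ T (suc r) e₄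
  ... | row₀ , o₃ , refl | row₀' , o₄ , refl with lookupM-map⁻ row₀ i e₅ | lookupM-map⁻ row₀' i' e₆
  ... | a₀ , o₅ , refl | b₀ , o₆ , refl =
    φ-< (lookupM-All (lookupM-All good o₃) o₅) (lookupM-All (lookupM-All good o₄) o₆)
        (colStrict r s s' l l' row₀ row₀' i i' a₀ b₀ e₁ e₂ o₃ o₄ o₅ o₆ e₇)

ssyt-tail : ∀ {row rows r T} → SemistandardSV (row ∷ rows) (r ∷ T) → SemistandardSV rows T
ssyt-tail ssyt = record
  { shape     = ∷-injectiveʳ shape
  ; cells     = All.tail cells
  ; rowWeak   = All.tail rowWeak
  ; colStrict = λ r → colStrict (suc r) }
  where open SemistandardSV ssyt

ssyt-cons : ∀ {s l rows r T} → SemistandardSV rows T → length r ≡ l → All IsCell r → Linked _≤C_ r →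
  All (λ a → All (All (a <C_)) T) r → SemistandardSV ((s , l) ∷ rows) (r ∷ T)
ssyt-cons {s} {l} {rows} {r} {T} ssyt length-r cells-r linked-r below = record
  { shape     = cong₂ _∷_ (sym length-r) shape
  ; cells     = cells-r ∷ cells
  ; rowWeak   = linked-r ∷ rowWeak
  ; colStrict = column }
  where
  open SemistandardSV ssyt
  column : ∀ i s₁ s₂ l₁ l₂ row row' j j' a b →
    lookupM ((s , l) ∷ rows) i ≡ just (s₁ , l₁) → lookupM ((s , l) ∷ rows) (suc i) ≡ just (s₂ , l₂) →
    lookupM (r ∷ T) i ≡ just row → lookupM (r ∷ T) (suc i) ≡ just row' →
    lookupM row j ≡ just a → lookupM row' j' ≡ just b → s₁ + j ≡ s₂ + j' → a <C b
  column zero    _ _ _ _ _ _ _ _ _ _ _ _ refl e₄ e₅ e₆ _ = lookupM-All (lookupM-All (lookupM-All below e₅) e₄) e₆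
  column (suc i) = colStrict i

module Shift (B k : ℕ) (l' mu : List ℕ) where

  R R' : Triple
  R  = triple (B ∷ l') mu (suc k) B
  R' = triple l' mu k B

  ones : List Cell
  ones = replicate B [ 1 ]

  attach : Tableau → Tableau
  attach D = ones ∷ shiftUp D

  lower : Tableau → Tableau
  lower []      = []
  lower (_ ∷ T) = shiftDown T

  lower-attach : ∀ D → lower (attach D) ≡ D
  lower-attach = shiftDown-shiftUp

  word-attach : ∀ D → word (attach D) ≡ lift B (word D)
  word-attach D = cong₂ _++_ (rowWord-ones B) (word-map suc D)

  buch-nonempty : ∀ {T} → Buch R T → Σ (List Cell) λ r → Σ Tableau λ T₁ → T ≡ r ∷ T₁
  buch-nonempty {r ∷ T₁} _ = r , T₁ , refl
  buch-nonempty {[]}     bu with SemistandardSV.shape (Buch.ssyt bu)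
  ... | ()

  -- The first row of a Buch tableau for R is a full row of {1}'s: its reading
  -- word is weakly decreasing and starts the reverse lattice word.
  first-row : ∀ {r T₁} → Buch R (r ∷ T₁) → r ≡ ones
  first-row {r} {T₁} bu = trans (all-replicate all-ones) (cong (λ n → replicate n [ 1 ]) (sym (∷-injectiveˡ shape)))
    where
    open SemistandardSV (Buch.ssyt bu)
    letters-one : All (_≡ 1) (rowWord r)
    letters-one = decreasing-lattice-ones (rowWord r) (word T₁)
                    (row-decreasing (All.head cells) (All.head rowWeak))
                    (from (row-letters r) (All.map cell-positive (All.head cells)))
                    (Buch.lattice bu)
    all-ones : All (_≡ [ 1 ]) r
    all-ones = All.zipWith (λ { (cell , entries) → cell-ones cell entries })
                           (All.head cells , to (row-letters r) letters-one)

  attach-lower : ∀ {T} → Buch R T → attach (lower T) ≡ T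
  attach-lower bu with buch-nonempty bu
  ... | r , T₁ , refl =
    cong₂ _∷_ (sym (first-row bu)) (shiftUp-shiftDown (All.tail (SemistandardSV.cells (Buch.ssyt bu))))

  buch-word : ∀ {T} → Buch R T → word T ≡ lift B (word (lower T))
  buch-word {T} bu = trans (cong word (sym (attach-lower bu))) (word-attach (lower T))

  buch-no-zero : ∀ {D} → Buch R' D → count 0 (word D) ≡ 0
  buch-no-zero {D} bu =
    count-positive (from (word-letters D) (All.map (All.map cell-positive) (SemistandardSV.cells (Buch.ssyt bu))))

  buch-lower : ∀ {T} → Buch R T → Buch R' (lower T)
  buch-lower {T} bu with buch-nonempty bu
  ... | r , T₁ , refl = record
    { ssyt    = ssyt-map down Big down-IsCell down-≤C down-<C big (ssyt-tail (Buch.ssyt bu))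
    ; lattice = lattice-unlift B w (subst IsReverseLattice (buch-word bu) (Buch.lattice bu))
    ; fits    = proj₂ unlifted }
    where
    open SemistandardSV (Buch.ssyt bu)
    w : List ℕ
    w = word (shiftDown T₁)
    unlifted : count 0 w ≡ 0 × ContentFits k B w
    unlifted = fits-unlift w (subst (ContentFits (suc k) B) (buch-word bu) (Buch.fits bu))
    -- Since w has no 0, the entries of T₁ = shiftUp (shiftDown T₁) are at least 2.
    word-T₁ : word T₁ ≡ map suc w
    word-T₁ = trans (cong word (sym (shiftUp-shiftDown (All.tail cells)))) (word-map suc (shiftDown T₁))
    big : All (All Big) T₁
    big = All.zipWith (λ { (cells-row , big-row) → All.zip (cells-row , big-row) })
            (All.tail cells ,
             to (word-letters T₁) (subst (All (1 <_)) (sym word-T₁)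
                                    (Allₚ.map⁺ (All.map (s≤s ∘ n≢0⇒n>0) (count-zero w (proj₁ unlifted))))))

  buch-attach : ∀ {D} → Buch R' D → Buch R (attach D)
  buch-attach {D} bu = record
    { ssyt    = ssyt-cons (ssyt-map up IsCell up-IsCell up-≤C up-<C cells (Buch.ssyt bu))
                          (length-replicate B) (Allₚ.replicate⁺ B ([-] , s≤s z≤n ∷ []))
                          (ones-linked B) (Allₚ.replicate⁺ B one-below)
    ; lattice = subst IsReverseLattice (sym (word-attach D))
                      (lattice-lift B (word D) (Buch.lattice bu) (proj₁ (Buch.fits bu) 1))
    ; fits    = subst (ContentFits (suc k) B) (sym (word-attach D))
                      (fits-lift (word D) (buch-no-zero bu) (Buch.fits bu)) }
    where
    open SemistandardSV (Buch.ssyt bu)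
    ones-linked : ∀ n → Linked _≤C_ (replicate n [ 1 ])
    ones-linked zero          = []
    ones-linked (suc zero)    = [-]
    ones-linked (suc (suc n)) = ≤-refl ∷ ones-linked (suc n)
    one-below : All (All ([ 1 ] <C_)) (shiftUp D)
    one-below = Allₚ.map⁺ (All.map (λ row → Allₚ.map⁺ (All.map (λ { {_ ∷ _} (_ , 0<y ∷ _) → s≤s 0<y }) row)) cells)

  content-attach : ∀ {D} → Buch R' D → content R (attach D) ≡ B ∷ content R' D
  content-attach {D} bu =
    trans (cong (λ u → tabulate (λ i → count (suc (toℕ i)) u)) (word-attach D))
          (counts-lift B (word D) (buch-no-zero bu))

  content-lower : ∀ {T} → Buch R T → content R T ≡ B ∷ content R' (lower T)
  content-lower {T} bu = trans (cong (content R) (sym (attach-lower bu))) (content-attach (buch-lower bu))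

  -- Every element of poset(R) has first part B, so it is determined by its tail.
  head-B : ∀ {ν} → InPoset R ν → Vec.head ν ≡ B
  head-B (T , bu , refl) = cong Vec.head (content-lower bu)

  cons-tail : ∀ {ν} → InPoset R ν → B ∷ Vec.tail ν ≡ ν
  cons-tail {x ∷ xs} p = cong (_∷ xs) (sym (head-B p))

  lower-labels : ∀ {ν T} → BuchWithContent R ν T → BuchWithContent R' (Vec.tail ν) (lower T)
  lower-labels (bu , refl) = buch-lower bu , cong Vec.tail (sym (content-lower bu))

  attach-labels : ∀ {ν' D} → BuchWithContent R' ν' D → BuchWithContent R (B ∷ ν') (attach D)
  attach-labels (bu , refl) = buch-attach bu , content-attach bu

  order-tail : ∀ ν₁ ν₂ → InPoset R ν₁ → InPoset R ν₂ → (ν₁ ≤P ν₂ ⇔ Vec.tail ν₁ ≤P Vec.tail ν₂)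
  order-tail (x ∷ xs) (y ∷ ys) p q = mk⇔ (λ le i → le (suc i)) extend
    where
    extend : xs ≤P ys → (x ∷ xs) ≤P (y ∷ ys)
    extend le zero    = ≤-reflexive (trans (head-B q) (sym (head-B p)))
    extend le (suc i) = le i

  iso : LabeledPosetIso R R'
  iso = record
    { f     = Vec.tail
    ; g     = B ∷_
    ; f-in  = λ { ν (T , labels) → lower T , lower-labels labels }
    ; g-in  = λ { ν' (D , labels) → attach D , attach-labels labels }
    ; gf    = λ ν → cons-tail
    ; fg    = λ ν' _ → refl
    ; order = order-tail
    ; h     = λ _ → lower
    ; h'    = λ _ → attach
    ; h-in  = λ ν T _ → lower-labels
    ; h'-in = λ ν D p labels → subst (λ μ → BuchWithContent R μ (attach D)) (cons-tail p) (attach-labels labels)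
    ; h'h   = λ { ν T _ (bu , _) → attach-lower bu }
    ; hh'   = λ ν D _ _ → lower-attach D }

-- With k = 0 the row λ₁ cannot fit in the 0 × (n−k) box; otherwise apply Shift.
lemma6 : (n k : ℕ) → k ≤ n → (l' mu : List ℕ) →
    IsPartition ((n ∸ k) ∷ l') → FitsIn k (n ∸ k) ((n ∸ k) ∷ l') →
    IsPartition mu → FitsIn k (n ∸ k) mu →
    LabeledPosetIso (triple ((n ∸ k) ∷ l') mu k (n ∸ k)) (triple l' mu (k ∸ 1) (n ∸ k))
lemma6 n zero    _ l' mu _ (() , _) _ _
lemma6 n (suc k) _ l' mu _ _        _ _ = Shift.iso (n ∸ suc k) k l' mu
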